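{- Let $\mathbb{F}$ be an arbitrary field and $\prec$ an arbitrary term order on the monomials of $\mathbb{F}[x_1,\ldots,x_n]$. Let $\mathcal{F}\subseteq\mathbb{F}^n$ be a finite subset, let $h\in\mathbb{F}^n\setminus\mathcal{F}$, and put $\mathcal{T}=\mathcal{F}\cup\{h\}$. Let $\mathcal{G}=\{g_1,\ldots,g_s\}$ be the reduced Gröbner basis of $I(\mathcal{F})$ with respect to $\prec$, indexed so that $\mathrm{lm}_\prec(g_1)\prec\cdots\prec\mathrm{lm}_\prec(g_s)$, and let $i=\min\{j: g_j(h)\ne0\}$. Let $\chi_h:\mathcal{T}\to\mathbb{F}$ be defined by $\chi_h(h)=1$ and $\chi_h(f)=0$ for $f\in\mathcal{F}$. Then $\chi_h$ coincides on $\mathcal{T}$ with $\frac{1}{g_i(h)}g_i$, and this gives the expansion of $\chi_h$ as the unique linear combination of standard monomials of the ideal $I(\mathcal{T})$.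
   Context: A term order is a total order on monomials with $1$ minimal and $uw\prec vw$ whenever $u\prec v$. $\mathrm{lm}_\prec(f)$ is the $\prec$-largest monomial occurring in $f$ with nonzero coefficient. $I(\mathcal{F})=\{f: f(v)=0\ \forall v\in\mathcal{F}\}$. A reduced Gröbner basis of $I$ is a finite generating subset $\mathcal{G}\subseteq I$ whose leading monomials generate the ideal of leading monomials of $I$, with each element monic and no monomial of $g_i$ divisible by $\mathrm{lm}(g_j)$, $j\ne i$. A standard monomial of $I$ is a monomial that is not the leading monomial of any nonzero element of $I$; standard monomials of $I(\mathcal{T})$ form a basis of the functions $\mathcal{T}\to\mathbb{F}$. -}

module Defs where

open import Level using (Level; _⊔_; suc)
open import Data.Nat as ℕ using (ℕ)
open import Data.Fin using (Fin)
open import Data.Vec using (Vec; zipWith; replicate; foldr; lookup; allFin)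
import Data.Vec.Properties as VecP
open import Data.List as List using (List; []; _∷_; map; concatMap; _++_)
open import Data.List.Membership.Propositional using (_∈_)
open import Data.Product using (Σ; ∃; _×_; _,_; proj₁; proj₂)
open import Relation.Nullary using (¬_; yes; no)
open import Relation.Binary.PropositionalEquality using (_≡_; _≢_)
open import Relation.Binary.Structures using (IsStrictTotalOrder)
open import Algebra.Bundles using (CommutativeRing)

record Field (c ℓ : Level) : Set (suc (c ⊔ ℓ)) where
  field
    commutativeRing : CommutativeRing c ℓ
  open CommutativeRing commutativeRing public
  field
    0≉1     : ¬ (0# ≈ 1#)
    inverse : ∀ x → ¬ (x ≈ 0#) → ∃ λ y → x * y ≈ 1#

Mono : ℕ → Set
Mono n = Vec ℕ n

mono1 : ∀ {n} → Mono n
mono1 = replicate _ 0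

_·ₘ_ : ∀ {n} → Mono n → Mono n → Mono n
_·ₘ_ = zipWith ℕ._+_

_∣ₘ_ : ∀ {n} → Mono n → Mono n → Set
_∣ₘ_ {n} u v = ∃ λ w → u ·ₘ w ≡ v

record TermOrder (n : ℕ) : Set₁ where
  field
    _≺_          : Mono n → Mono n → Set
    isStrictTotalOrder : IsStrictTotalOrder _≡_ _≺_
    one-minimal  : ∀ m → m ≢ mono1 → mono1 ≺ m
    compatible   : ∀ u v w → u ≺ v → (u ·ₘ w) ≺ (v ·ₘ w)

  _≼_ : Mono n → Mono n → Set
  u ≼ v = u ≺ v Data.Sum.⊎ u ≡ v
    where import Data.Sum

-- Two polynomials are equal iff all their
-- coefficients agree (coefficients of repeated monomials are summed).

module Poly {c ℓ} (K : Field c ℓ) (n : ℕ) where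
  open Field K

  Pol : Set c
  Pol = List (Carrier × Mono n)

  coeff : Pol → Mono n → Carrier
  coeff [] m = 0#
  coeff ((a , u) ∷ f) m with VecP.≡-dec ℕ._≟_ u m
  ... | yes _ = a + coeff f m
  ... | no  _ = coeff f m

  _≈ₚ_ : Pol → Pol → Set ℓ
  f ≈ₚ g = ∀ m → coeff f m ≈ coeff g m

  Occurs : Pol → Mono n → Set ℓ
  Occurs f m = ¬ (coeff f m ≈ 0#)

  _+ₚ_ : Pol → Pol → Pol
  _+ₚ_ = _++_

  _*ₚ_ : Pol → Pol → Pol
  f *ₚ g = concatMap (λ { (a , u) → map (λ { (b , v) → (a * b , u ·ₘ v) }) g }) f

  0ₚ : Pol
  0ₚ = []

  Point : Set c
  Point = Vec Carrier n

  _^_ : Carrier → ℕ → Carrier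
  x ^ ℕ.zero  = 1#
  x ^ ℕ.suc k = x * (x ^ k)

  evalMono : Mono n → Point → Carrier
  evalMono u v = foldr _ _*_ 1# (zipWith _^_ v u)

  eval : Pol → Point → Carrier
  eval [] v = 0#
  eval ((a , u) ∷ f) v = a * evalMono u v + eval f v

  InI : List Point → Pol → Set (c ⊔ ℓ)
  InI 𝓕 f = ∀ v → v ∈ 𝓕 → eval f v ≈ 0#

  _≈ᵥ_ : Point → Point → Set ℓ
  v ≈ᵥ w = ∀ k → lookup v k ≈ lookup w k

  lincomb : ∀ {s} → (Fin s → Pol) → (Fin s → Pol) → Pol
  lincomb {s} q g = foldr _ (λ j acc → (q j *ₚ g j) +ₚ acc) 0ₚ (allFin s)

  module _ (O : TermOrder n) where
    open TermOrder O

    IsLM : Pol → Mono n → Set ℓ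
    IsLM f m = Occurs f m × (∀ u → Occurs f u → u ≼ m)

    Standard : List Point → Mono n → Set (c ⊔ ℓ)
    Standard 𝓣 m = ∀ f → InI 𝓣 f → ¬ IsLM f m

    record IsReducedGB (𝓕 : List Point) {s : ℕ} (g : Fin s → Pol)
                       (lm : Fin s → Mono n) : Set (c ⊔ ℓ) where
      field
        lm-is-lm   : ∀ j → IsLM (g j) (lm j)
        in-ideal   : ∀ j → InI 𝓕 (g j)
        generates  : ∀ f → InI 𝓕 f → ∃ λ (q : Fin s → Pol) → f ≈ₚ lincomb q g
        lm-generate : ∀ f m → InI 𝓕 f → IsLM f m → ∃ λ j → lm j ∣ₘ m
        monic      : ∀ j → coeff (g j) (lm j) ≈ 1#
        reduced    : ∀ i j → i ≢ j → ∀ u → Occurs (g i) u → ¬ (lm j ∣ₘ u)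

module Submission where

-- Since gᵢ ∈ I(𝓕) and gᵢ(h) ≉ 0, the polynomial gᵢ/gᵢ(h) is χ_h on 𝓣; what
-- must be shown is that each monomial u of gᵢ is standard for I(𝓣).  If
-- u = lm f with f ∈ I(𝓣) ⊆ I(𝓕), some lm gⱼ divides u; as 𝓖 is reduced
-- this forces j = i and u = lm gᵢ.  Then f − c·gᵢ lies in I(𝓕), has all its
-- monomials below lm gᵢ, and does not vanish at h.  But dividing such a
-- polynomial by 𝓖 only ever uses the gⱼ with lm gⱼ ≺ lm gᵢ, that is j < i,
-- and these vanish at h; so it vanishes at h.
--
-- Division terminates because a term order is well founded, which follows
-- from Dickson's lemma, proved constructively with almost-full relations.
-- Equality in 𝔽 is not decidable, so leading monomials are found only under
-- a double negation; this suffices because every use ends in a contradiction.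

open import Defs
open import Level using (Level; 0ℓ)
open import Data.Nat as ℕ using (ℕ; _≤_; _∸_; _≟_; _≤?_; _<?_)
import Data.Nat.Properties as ℕₚ
open import Data.Nat.Induction using (<-rec)
open import Data.Fin as Fin using (Fin; _<_)
open import Data.Fin.Properties using (<-cmp)
open import Data.Vec using (Vec; []; _∷_; head; tail; foldr; zipWith; replicate)
open import Data.Vec.Properties
  using (≡-dec; ∷-injectiveˡ; ∷-injectiveʳ; zipWith-comm; zipWith-identityˡ; zipWith-identityʳ)
open import Data.List using (List; []; _∷_; _++_; map; length)
open import Data.List.Membership.Propositional using (_∈_)
open import Data.List.Relation.Unary.Any using (here; there)
open import Data.Product using (_×_; _,_; proj₁; proj₂; ∃)
open import Data.Sum as Sum using (_⊎_; inj₁; inj₂)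
open import Data.Empty using (⊥-elim)
open import Function using (_on_; _∘_)
open import Induction.WellFounded using (Acc; acc; WellFounded)
open import Relation.Binary.Core using (Rel; _⇒_)
open import Relation.Binary.Construct.Intersection using (_∩_)
open import Relation.Binary.Definitions using (Transitive; tri<; tri≈; tri>)
open import Relation.Binary.Structures using (IsStrictTotalOrder)
import Relation.Binary.PropositionalEquality as ≡
open ≡ using (_≡_; _≢_)
open import Relation.Nullary using (¬_; Dec; yes; no)
open import Relation.Nullary.Decidable using (¬¬-excluded-middle)

private variable
  A B : Set
  R S T : Rel A 0ℓ

_↑_ : Rel A 0ℓ → A → Rel A 0ℓ
(R ↑ x) y z = R y z ⊎ R x y

-- Almost-full relations in the inductive form of Vytiniotis, Coquand and
-- Wahlstedt: classically, AlmostFull R says that every infinite sequence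
-- x₀ x₁ … has xᵢ R xⱼ for some i < j.
data AlmostFull {A : Set} (R : Rel A 0ℓ) : Set where
  now   : (∀ x y → R x y) → AlmostFull R
  later : (∀ x → AlmostFull (R ↑ x)) → AlmostFull R

AlmostFull-mono : R ⇒ S → AlmostFull R → AlmostFull S
AlmostFull-mono R⇒S (now r)   = now λ x y → R⇒S (r x y)
AlmostFull-mono R⇒S (later k) = later λ x → AlmostFull-mono (Sum.map R⇒S R⇒S) (k x)

AlmostFull-on : (f : A → B) → AlmostFull R → AlmostFull (R on f)
AlmostFull-on f (now r)   = now λ x y → r (f x) (f y)
AlmostFull-on f (later k) = later λ x → AlmostFull-on f (k (f x))

private
  merge : ∀ {C P Q : Set} → C ⊎ P → C ⊎ Q → C ⊎ (P × Q)
  merge (inj₁ c) _        = inj₁ c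
  merge (inj₂ p) (inj₁ c) = inj₁ c
  merge (inj₂ p) (inj₂ q) = inj₂ (p , q)

  lift : ∀ {W : A → Set} x → R ⇒ (λ y z → T y z ⊎ W y) →
         (R ↑ x) ⇒ (λ y z → ((T ↑ x) y z ⊎ W x) ⊎ W y)
  lift x R⇒ (inj₁ r) = Sum.map₁ (inj₁ ∘ inj₁) (R⇒ r)
  lift x R⇒ (inj₂ r) = inj₁ (Sum.map₁ inj₂ (R⇒ r))

  reorder : ∀ {C P W : Set} → (C ⊎ P) ⊎ W → (C ⊎ W) ⊎ P
  reorder (inj₁ (inj₁ c)) = inj₁ (inj₁ c)
  reorder (inj₁ (inj₂ p)) = inj₂ p
  reorder (inj₂ w)        = inj₁ (inj₂ w)

-- The two lemmas below are the Ramsey-type core of AlmostFull-∩.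
AlmostFull-∪-const : ∀ {P Q : Set} → AlmostFull R → AlmostFull S →
  R ⇒ (λ x y → T x y ⊎ P) → S ⇒ (λ x y → T x y ⊎ Q) →
  AlmostFull (λ x y → T x y ⊎ (P × Q))
AlmostFull-∪-const (now r) s R⇒ S⇒ =
  AlmostFull-mono (λ {x} {y} sxy → merge (R⇒ (r x y)) (S⇒ sxy)) s
AlmostFull-∪-const {R = R} {T = T} {P = P} {Q = Q} (later k) s R⇒ S⇒ = later λ x →
  AlmostFull-mono (regroup x)
    (AlmostFull-∪-const (k x) s (lift↑ x) (λ sxy → Sum.map₁ inj₁ (S⇒ sxy)))
  where
  lift↑ : ∀ x → (R ↑ x) ⇒ (λ y z → (T ↑ x) y z ⊎ P)
  lift↑ x (inj₁ r) = Sum.map₁ inj₁ (R⇒ r)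
  lift↑ x (inj₂ r) = Sum.map₁ inj₂ (R⇒ r)
  regroup : ∀ x → (λ y z → (T ↑ x) y z ⊎ (P × Q)) ⇒ ((λ y z → T y z ⊎ (P × Q)) ↑ x)
  regroup x (inj₁ (inj₁ t)) = inj₁ (inj₁ t)
  regroup x (inj₁ (inj₂ t)) = inj₂ (inj₁ t)
  regroup x (inj₂ pq)       = inj₁ (inj₂ pq)

AlmostFull-∪-unary : ∀ {U V : A → Set} → AlmostFull R → AlmostFull S →
  R ⇒ (λ x y → T x y ⊎ U x) → S ⇒ (λ x y → T x y ⊎ V x) →
  AlmostFull (λ x y → T x y ⊎ (U x × V x))
AlmostFull-∪-unary (now r) s R⇒ S⇒ =
  AlmostFull-mono (λ {x} {y} sxy → merge (R⇒ (r x y)) (S⇒ sxy)) s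
AlmostFull-∪-unary (later k) (now s) R⇒ S⇒ =
  AlmostFull-mono (λ {x} {y} rxy → merge (R⇒ rxy) (S⇒ (s x y))) (later k)
AlmostFull-∪-unary {R = R} {S = S} {T = T} {U = U} {V = V} (later kr) (later ks) R⇒ S⇒ =
  later λ x → AlmostFull-mono (regroup x)
    (AlmostFull-∪-const (left x) (right x) (λ l → l) (λ r → r))
  where
  left : ∀ x → AlmostFull (λ y z → ((T ↑ x) y z ⊎ (U y × V y)) ⊎ U x)
  left x = AlmostFull-mono reorder
    (AlmostFull-∪-unary (kr x) (later ks) (lift {R = R} x R⇒)
      (λ s → Sum.map₁ (inj₁ ∘ inj₁) (S⇒ s)))
  right : ∀ x → AlmostFull (λ y z → ((T ↑ x) y z ⊎ (U y × V y)) ⊎ V x)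
  right x = AlmostFull-mono reorder
    (AlmostFull-∪-unary (later kr) (ks x) (λ r → Sum.map₁ (inj₁ ∘ inj₁) (R⇒ r))
      (lift {R = S} x S⇒))
  regroup : ∀ x → (λ y z → ((T ↑ x) y z ⊎ (U y × V y)) ⊎ (U x × V x)) ⇒
                  ((λ y z → T y z ⊎ (U y × V y)) ↑ x)
  regroup x (inj₁ (inj₁ (inj₁ t))) = inj₁ (inj₁ t)
  regroup x (inj₁ (inj₁ (inj₂ t))) = inj₂ (inj₁ t)
  regroup x (inj₁ (inj₂ uv))       = inj₁ (inj₂ uv)
  regroup x (inj₂ uv)              = inj₂ (inj₂ uv)

AlmostFull-∩ : AlmostFull R → AlmostFull S → AlmostFull (R ∩ S)
AlmostFull-∩ (now r) s = AlmostFull-mono (λ {x} {y} sxy → r x y , sxy) s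
AlmostFull-∩ (later k) (now s) = AlmostFull-mono (λ {x} {y} rxy → rxy , s x y) (later k)
AlmostFull-∩ {R = R} {S = S} (later kr) (later ks) = later λ x →
  AlmostFull-∪-unary {T = R ∩ S} {U = R x} {V = S x}
    (AlmostFull-∩ (kr x) (later ks)) (AlmostFull-∩ (later kr) (ks x))
    (λ { (inj₁ r , s) → inj₁ (r , s) ; (inj₂ r , _) → inj₂ r })
    (λ { (r , inj₁ s) → inj₁ (r , s) ; (_ , inj₂ s) → inj₂ s })

module _ {_<_ : Rel A 0ℓ} (<-trans : Transitive _<_) where

  private
    acc-below : AlmostFull R → ∀ z →
      (∀ {a b} → a ≡ z ⊎ a < z → b < a → ¬ R a b) → Acc _<_ z
    acc-below (now r) z bad = acc λ {y} y<z → ⊥-elim (bad (inj₁ ≡.refl) y<z (r z y))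
    acc-below {R = R} (later k) z bad = acc λ y<z → acc-below (k z) _ (bad↑ y<z)
      where
      bad↑ : ∀ {y} → y < z → ∀ {a b} → a ≡ y ⊎ a < y → b < a → ¬ (R ↑ z) a b
      bad↑ y<z (inj₁ ≡.refl) b<a (inj₁ r) = bad (inj₂ y<z) b<a r
      bad↑ y<z (inj₂ a<y)  b<a (inj₁ r) = bad (inj₂ (<-trans a<y y<z)) b<a r
      bad↑ y<z (inj₁ ≡.refl) b<a (inj₂ r) = bad (inj₁ ≡.refl) y<z r
      bad↑ y<z (inj₂ a<y)  b<a (inj₂ r) = bad (inj₁ ≡.refl) (<-trans a<y y<z) r

  AlmostFull⇒WellFounded : AlmostFull R → (∀ {a b} → b < a → ¬ R a b) → WellFounded _<_
  AlmostFull⇒WellFounded af bad z = acc-below af z (λ _ → bad)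

≤-almostFull : AlmostFull _≤_
≤-almostFull = later (<-rec _ ↑-almostFull)
  where
  ↑-almostFull : ∀ k → (∀ {j} → j ℕ.< k → AlmostFull (_≤_ ↑ j)) → AlmostFull (_≤_ ↑ k)
  ↑-almostFull k rec = later λ x → by-cases x (x <? k)
    where
    by-cases : ∀ x → Dec (x ℕ.< k) → AlmostFull ((_≤_ ↑ k) ↑ x)
    by-cases x (yes x<k) = AlmostFull-mono (Sum.map inj₁ inj₁) (rec x<k)
    by-cases x (no x≮k)  = now λ _ _ → inj₂ (inj₂ (ℕₚ.≮⇒≥ x≮k))

·ₘ-comm : ∀ {n} (u v : Mono n) → u ·ₘ v ≡ v ·ₘ u
·ₘ-comm = zipWith-comm ℕₚ.+-comm

·ₘ-identityˡ : ∀ {n} (u : Mono n) → mono1 ·ₘ u ≡ u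
·ₘ-identityˡ = zipWith-identityˡ ℕₚ.+-identityˡ

·ₘ-identityʳ : ∀ {n} (u : Mono n) → u ·ₘ mono1 ≡ u
·ₘ-identityʳ = zipWith-identityʳ ℕₚ.+-identityʳ

·ₘ-cancelˡ : ∀ {n} (w u v : Mono n) → w ·ₘ u ≡ w ·ₘ v → u ≡ v
·ₘ-cancelˡ []      []      []      _  = ≡.refl
·ₘ-cancelˡ (a ∷ w) (b ∷ u) (c ∷ v) eq =
  ≡.cong₂ _∷_ (ℕₚ.+-cancelˡ-≡ a b c (∷-injectiveˡ eq)) (·ₘ-cancelˡ w u v (∷-injectiveʳ eq))

∷-∣ₘ : ∀ {n a b} {u v : Mono n} → a ≤ b → u ∣ₘ v → (a ∷ u) ∣ₘ (b ∷ v)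
∷-∣ₘ {a = a} {b} a≤b (w , ≡.refl) = (b ∸ a ∷ w) , ≡.cong (_∷ _) (ℕₚ.m+[n∸m]≡n a≤b)

_∣ₘ?_ : ∀ {n} (u v : Mono n) → Dec (u ∣ₘ v)
[]      ∣ₘ? []      = yes ([] , ≡.refl)
(a ∷ u) ∣ₘ? (b ∷ v) with a ≤? b | u ∣ₘ? v
... | yes a≤b | yes u∣v = yes (∷-∣ₘ a≤b u∣v)
... | yes _   | no u∤v  = no λ { (_ ∷ w , e) → u∤v (w , ∷-injectiveʳ e) }
... | no a≰b  | _       = no λ { (c ∷ _ , e) → a≰b (≡.subst (a ≤_) (∷-injectiveˡ e) (ℕₚ.m≤m+n a c)) }

∣ₘ-almostFull : ∀ n → AlmostFull (_∣ₘ_ {n})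
∣ₘ-almostFull ℕ.zero    = now λ { [] [] → [] , ≡.refl }
∣ₘ-almostFull (ℕ.suc n) =
  AlmostFull-mono (λ { {_ ∷ _} {_ ∷ _} (a≤b , u∣v) → ∷-∣ₘ a≤b u∣v })
    (AlmostFull-∩ (AlmostFull-on head ≤-almostFull) (AlmostFull-on tail (∣ₘ-almostFull n)))

module TermOrderProperties {n : ℕ} (O : TermOrder n) where

  open TermOrder O
  open IsStrictTotalOrder isStrictTotalOrder public using () renaming (trans to ≺-trans)
  open IsStrictTotalOrder isStrictTotalOrder using (compare; irrefl; <-respʳ-≈; <-respˡ-≈)
  open import Relation.Binary.Construct.StrictToNonStrict _≡_ _≺_
    using (<-≤-trans; ≤-<-trans)

  ≺-≼-trans : ∀ {u v w} → u ≺ v → v ≼ w → u ≺ w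
  ≺-≼-trans = <-≤-trans ≺-trans <-respʳ-≈

  ≼-≺-trans : ∀ {u v w} → u ≼ v → v ≺ w → u ≺ w
  ≼-≺-trans = ≤-<-trans ≡.sym ≺-trans <-respˡ-≈

  ≺⇒⋡ : ∀ {u v} → u ≺ v → ¬ (v ≼ u)
  ≺⇒⋡ u≺v v≼u = irrefl ≡.refl (≺-≼-trans u≺v v≼u)

  ≼-or-≻ : ∀ u v → u ≼ v ⊎ v ≺ u
  ≼-or-≻ u v with compare u v
  ... | tri< u≺v _ _ = inj₁ (inj₁ u≺v)
  ... | tri≈ _ u≡v _ = inj₁ (inj₂ u≡v)
  ... | tri> _ _ v≺u = inj₂ v≺u

  ∣ₘ⇒≼ : ∀ {u v} → u ∣ₘ v → u ≼ v
  ∣ₘ⇒≼ {u} (w , ≡.refl) with ≡-dec _≟_ w mono1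
  ... | yes ≡.refl   = inj₂ (≡.sym (·ₘ-identityʳ u))
  ... | no w≢1     = inj₁ (≡.subst₂ _≺_ (·ₘ-identityˡ u) (·ₘ-comm w u)
                                      (compatible mono1 w u (one-minimal w w≢1)))

  ·ₘ-monoʳ-≼ : ∀ w {u v} → u ≼ v → (w ·ₘ u) ≼ (w ·ₘ v)
  ·ₘ-monoʳ-≼ w {u} {v} (inj₁ u≺v) =
    inj₁ (≡.subst₂ _≺_ (·ₘ-comm u w) (·ₘ-comm v w) (compatible u v w u≺v))
  ·ₘ-monoʳ-≼ w (inj₂ ≡.refl) = inj₂ ≡.refl

  ≺-wellFounded : WellFounded _≺_
  ≺-wellFounded = AlmostFull⇒WellFounded ≺-trans (∣ₘ-almostFull n) λ v≺u u∣v → ≺⇒⋡ v≺u (∣ₘ⇒≼ u∣v)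

module PolyProperties {c ℓ} (K : Field c ℓ) (n : ℕ) where

  open Field K
  open Poly K n
  open import Relation.Binary.Reasoning.Setoid setoid
  open import Algebra.Properties.CommutativeSemigroup *-commutativeSemigroup
    using () renaming (interchange to *-interchange)
  open import Algebra.Properties.CommutativeSemigroup +-commutativeSemigroup
    using () renaming (x∙yz≈y∙xz to +-leftComm)
  open import Algebra.Properties.Group +-group using (ε⁻¹≈ε; ⁻¹-injective)

  ^-distribˡ-+-* : ∀ x a b → x ^ (a ℕ.+ b) ≈ x ^ a * x ^ b
  ^-distribˡ-+-* x ℕ.zero    b = sym (*-identityˡ _)
  ^-distribˡ-+-* x (ℕ.suc a) b = trans (*-cong refl (^-distribˡ-+-* x a b)) (sym (*-assoc _ _ _))

  -- evalMono at an arbitrary number of variables, so that it can be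
  -- computed by recursion on the exponent vector.
  private
    evalMono′ : ∀ {k} → Vec ℕ k → Vec Carrier k → Carrier
    evalMono′ u x = foldr _ _*_ 1# (zipWith _^_ x u)

    evalMono′-·ₘ : ∀ {k} (u w : Vec ℕ k) x → evalMono′ (u ·ₘ w) x ≈ evalMono′ u x * evalMono′ w x
    evalMono′-·ₘ []      []      []      = sym (*-identityˡ _)
    evalMono′-·ₘ (a ∷ u) (b ∷ w) (x ∷ v) = begin
      x ^ (a ℕ.+ b) * evalMono′ (u ·ₘ w) v
        ≈⟨ *-cong (^-distribˡ-+-* x a b) (evalMono′-·ₘ u w v) ⟩
      (x ^ a * x ^ b) * (evalMono′ u v * evalMono′ w v)
        ≈⟨ *-interchange _ _ _ _ ⟩
      (x ^ a * evalMono′ u v) * (x ^ b * evalMono′ w v) ∎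

    evalMono′-mono1 : ∀ {k} (x : Vec Carrier k) → evalMono′ (replicate k 0) x ≈ 1#
    evalMono′-mono1 []      = refl
    evalMono′-mono1 (x ∷ v) = trans (*-identityˡ _) (evalMono′-mono1 v)

  evalMono-·ₘ : ∀ u w x → evalMono (u ·ₘ w) x ≈ evalMono u x * evalMono w x
  evalMono-·ₘ = evalMono′-·ₘ

  evalMono-mono1 : ∀ x → evalMono mono1 x ≈ 1#
  evalMono-mono1 = evalMono′-mono1

  *-nonzero : ∀ {x y} → x ≉ 0# → y ≉ 0# → x * y ≉ 0#
  *-nonzero {x} {y} x≉0 y≉0 xy≈0 with inverse x x≉0
  ... | x⁻¹ , xx⁻¹≈1 = y≉0 (begin
    y              ≈⟨ sym (*-identityˡ y) ⟩
    1# * y         ≈⟨ *-cong (trans (sym xx⁻¹≈1) (*-comm x x⁻¹)) refl ⟩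
    (x⁻¹ * x) * y  ≈⟨ *-assoc x⁻¹ x y ⟩
    x⁻¹ * (x * y)  ≈⟨ *-cong refl xy≈0 ⟩
    x⁻¹ * 0#       ≈⟨ zeroʳ x⁻¹ ⟩
    0#             ∎)

  -‿nonzero : ∀ {x} → x ≉ 0# → - x ≉ 0#
  -‿nonzero x≉0 -x≈0 = x≉0 (⁻¹-injective (trans -x≈0 (sym ε⁻¹≈ε)))

  1≉0 : 1# ≉ 0#
  1≉0 = 0≉1 ∘ sym

  scale : Carrier → Mono n → Pol → Pol
  scale a w f = ((a , w) ∷ []) *ₚ f

  eval-++ : ∀ f g x → eval (f ++ g) x ≈ eval f x + eval g x
  eval-++ []            g x = sym (+-identityˡ _)
  eval-++ ((a , u) ∷ f) g x = trans (+-cong refl (eval-++ f g x)) (sym (+-assoc _ _ _))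

  coeff-++ : ∀ f g m → coeff (f ++ g) m ≈ coeff f m + coeff g m
  coeff-++ []            g m = sym (+-identityˡ _)
  coeff-++ ((a , u) ∷ f) g m with ≡-dec _≟_ u m
  ... | yes _ = trans (+-cong refl (coeff-++ f g m)) (sym (+-assoc _ _ _))
  ... | no  _ = coeff-++ f g m

  eval-scale : ∀ a w f x → eval (scale a w f) x ≈ (a * evalMono w x) * eval f x
  eval-scale a w []            x = sym (zeroʳ _)
  eval-scale a w ((b , v) ∷ f) x = begin
    (a * b) * evalMono (w ·ₘ v) x + eval (scale a w f) x
      ≈⟨ +-cong (*-cong refl (evalMono-·ₘ w v x)) (eval-scale a w f x) ⟩
    (a * b) * (evalMono w x * evalMono v x) + (a * evalMono w x) * eval f x
      ≈⟨ +-cong (*-interchange a b _ _) refl ⟩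
    (a * evalMono w x) * (b * evalMono v x) + (a * evalMono w x) * eval f x
      ≈⟨ sym (distribˡ _ _ _) ⟩
    (a * evalMono w x) * (b * evalMono v x + eval f x) ∎

  coeff-scale : ∀ a w f v → coeff (scale a w f) (w ·ₘ v) ≈ a * coeff f v
  coeff-scale a w []            v = sym (zeroʳ _)
  coeff-scale a w ((b , u) ∷ f) v with ≡-dec _≟_ (w ·ₘ u) (w ·ₘ v) | ≡-dec _≟_ u v
  ... | yes _     | yes _   = trans (+-cong refl (coeff-scale a w f v)) (sym (distribˡ _ _ _))
  ... | yes wu≡wv | no u≢v  = ⊥-elim (u≢v (·ₘ-cancelˡ w u v wu≡wv))
  ... | no wu≢wv  | yes u≡v = ⊥-elim (wu≢wv (≡.cong (w ·ₘ_) u≡v))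
  ... | no _      | no _    = coeff-scale a w f v

  coeff-scale-∤ : ∀ a {w} f {u} → ¬ (w ∣ₘ u) → coeff (scale a w f) u ≈ 0#
  coeff-scale-∤ a []            w∤u = refl
  coeff-scale-∤ a {w} ((b , v) ∷ f) {u} w∤u with ≡-dec _≟_ (w ·ₘ v) u
  ... | yes wv≡u = ⊥-elim (w∤u (v , wv≡u))
  ... | no  _    = coeff-scale-∤ a f w∤u

  Occurs-scale : ∀ a w f u → Occurs (scale a w f) u → ∃ λ v → w ·ₘ v ≡ u × Occurs f v
  Occurs-scale a w f u occ with w ∣ₘ? u
  ... | no w∤u         = ⊥-elim (occ (coeff-scale-∤ a f w∤u))
  ... | yes (v , ≡.refl) = v , ≡.refl , λ fv≈0 →
    occ (trans (coeff-scale a w f v) (trans (*-cong refl fv≈0) (zeroʳ a)))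

  Occurs-++ : ∀ f g u → Occurs (f ++ g) u → ¬ ¬ (Occurs f u ⊎ Occurs g u)
  Occurs-++ f g u occ neither =
    neither (inj₁ λ fu≈0 → neither (inj₂ λ gu≈0 →
      occ (trans (coeff-++ f g u) (trans (+-cong fu≈0 gu≈0) (+-identityˡ 0#)))))

  remove : Mono n → Pol → Pol
  remove u []            = []
  remove u ((a , v) ∷ f) with ≡-dec _≟_ v u
  ... | yes _ = remove u f
  ... | no  _ = (a , v) ∷ remove u f

  length-remove : ∀ u f → length (remove u f) ℕ.≤ length f
  length-remove u []            = ℕ.z≤n
  length-remove u ((a , v) ∷ f) with ≡-dec _≟_ v u
  ... | yes _ = ℕₚ.m≤n⇒m≤1+n (length-remove u f)
  ... | no  _ = ℕ.s≤s (length-remove u f)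

  coeff-remove-≡ : ∀ u f → coeff (remove u f) u ≈ 0#
  coeff-remove-≡ u []            = refl
  coeff-remove-≡ u ((a , v) ∷ f) with ≡-dec _≟_ v u
  ... | yes _   = coeff-remove-≡ u f
  ... | no  v≢u with ≡-dec _≟_ v u
  ...   | yes v≡u = ⊥-elim (v≢u v≡u)
  ...   | no  _   = coeff-remove-≡ u f

  coeff-remove-≢ : ∀ u f {m} → u ≢ m → coeff (remove u f) m ≈ coeff f m
  coeff-remove-≢ u []            u≢m = refl
  coeff-remove-≢ u ((a , v) ∷ f) {m} u≢m with ≡-dec _≟_ v u
  ... | yes ≡.refl with ≡-dec _≟_ v m
  ...   | yes v≡m = ⊥-elim (u≢m v≡m)
  ...   | no  _   = coeff-remove-≢ u f u≢m
  coeff-remove-≢ u ((a , v) ∷ f) {m} u≢m | no _ with ≡-dec _≟_ v m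
  ...   | yes _ = +-cong refl (coeff-remove-≢ u f u≢m)
  ...   | no  _ = coeff-remove-≢ u f u≢m

  eval-remove : ∀ u f x → eval f x ≈ coeff f u * evalMono u x + eval (remove u f) x
  eval-remove u []            x = sym (trans (+-identityʳ _) (zeroˡ _))
  eval-remove u ((a , v) ∷ f) x with ≡-dec _≟_ v u
  ... | yes ≡.refl = begin
    a * evalMono v x + eval f x
      ≈⟨ +-cong refl (eval-remove v f x) ⟩
    a * evalMono v x + (coeff f v * evalMono v x + eval (remove v f) x)
      ≈⟨ sym (+-assoc _ _ _) ⟩
    (a * evalMono v x + coeff f v * evalMono v x) + eval (remove v f) x
      ≈⟨ +-cong (sym (distribʳ _ _ _)) refl ⟩
    (a + coeff f v) * evalMono u x + eval (remove u f) x ∎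
  ... | no _ = trans (+-cong refl (eval-remove u f x)) (+-leftComm _ _ _)

  remove-here : ∀ a u f → remove u ((a , u) ∷ f) ≡ remove u f
  remove-here a u f with ≡-dec _≟_ u u
  ... | yes _   = ≡.refl
  ... | no  u≢u = ⊥-elim (u≢u ≡.refl)

  eval-zero-coeffs : ∀ f → (∀ m → coeff f m ≈ 0#) → ∀ x → eval f x ≈ 0#
  eval-zero-coeffs f f≈0 x = go (length f) f ℕₚ.≤-refl f≈0
    where
    go : ∀ k f → length f ℕ.≤ k → (∀ m → coeff f m ≈ 0#) → eval f x ≈ 0#
    go _ [] _ _ = refl
    go (ℕ.suc k) F@((a , u) ∷ f) (ℕ.s≤s len≤k) F≈0 = begin
      eval F x                                ≈⟨ eval-remove u F x ⟩
      coeff F u * evalMono u x + eval (remove u F) x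
        ≈⟨ +-cong (trans (*-cong (F≈0 u) refl) (zeroˡ _)) (go k (remove u F) len′ remove≈0) ⟩
      0# + 0#                                 ≈⟨ +-identityʳ 0# ⟩
      0#                                      ∎
      where
      len′ : length (remove u F) ℕ.≤ k
      len′ = ≡.subst (λ g → length g ℕ.≤ k) (≡.sym (remove-here a u f))
                     (ℕₚ.≤-trans (length-remove u f) len≤k)
      remove≈0 : ∀ m → coeff (remove u F) m ≈ 0#
      remove≈0 m with ≡-dec _≟_ u m
      ... | yes ≡.refl = coeff-remove-≡ u F
      ... | no  u≢m    = trans (coeff-remove-≢ u F u≢m) (F≈0 m)

  InI-++ : ∀ {𝓕} f g → InI 𝓕 f → InI 𝓕 g → InI 𝓕 (f ++ g)
  InI-++ f g f∈I g∈I v v∈𝓕 =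
    trans (eval-++ f g v) (trans (+-cong (f∈I v v∈𝓕) (g∈I v v∈𝓕)) (+-identityʳ 0#))

  InI-scale : ∀ {𝓕} a w f → InI 𝓕 f → InI 𝓕 (scale a w f)
  InI-scale a w f f∈I v v∈𝓕 =
    trans (eval-scale a w f v) (trans (*-cong refl (f∈I v v∈𝓕)) (zeroʳ _))

  InI-∷ : ∀ {𝓕 x} f → InI (x ∷ 𝓕) f → InI 𝓕 f
  InI-∷ f f∈I v v∈𝓕 = f∈I v (there v∈𝓕)

  divisionStep : Pol → Mono n → Mono n → Pol → Pol
  divisionStep r m w g = r ++ scale (- coeff r m) w g

  InI-divisionStep : ∀ {𝓕} r m w g → InI 𝓕 r → InI 𝓕 g → InI 𝓕 (divisionStep r m w g)
  InI-divisionStep r m w g r∈I g∈I = InI-++ r _ r∈I (InI-scale _ w g g∈I)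

  eval-divisionStep : ∀ r m w g x →
    eval (divisionStep r m w g) x ≈ eval r x + (- coeff r m * evalMono w x) * eval g x
  eval-divisionStep r m w g x = trans (eval-++ r _ x) (+-cong refl (eval-scale _ w g x))

  divisionStep-at-root : ∀ r m w g x → eval g x ≈ 0# → eval (divisionStep r m w g) x ≈ eval r x
  divisionStep-at-root r m w g x g[x]≈0 = begin
    eval (divisionStep r m w g) x                         ≈⟨ eval-divisionStep r m w g x ⟩
    eval r x + (- coeff r m * evalMono w x) * eval g x    ≈⟨ +-cong refl (*-cong refl g[x]≈0) ⟩
    eval r x + (- coeff r m * evalMono w x) * 0#          ≈⟨ +-cong refl (zeroʳ _) ⟩
    eval r x + 0#                                         ≈⟨ +-identityʳ _ ⟩
    eval r x                                              ∎

  divisionStep-≉0 : ∀ r m g x → eval r x ≈ 0# → coeff r m ≉ 0# → eval g x ≉ 0# →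
                    eval (divisionStep r m mono1 g) x ≉ 0#
  divisionStep-≉0 r m g x r[x]≈0 rₘ≉0 g[x]≉0 step≈0 =
    *-nonzero (*-nonzero (-‿nonzero rₘ≉0) mono1[x]≉0) g[x]≉0 (begin
      (- coeff r m * evalMono mono1 x) * eval g x             ≈⟨ sym (+-identityˡ _) ⟩
      0# + (- coeff r m * evalMono mono1 x) * eval g x        ≈⟨ +-cong (sym r[x]≈0) refl ⟩
      eval r x + (- coeff r m * evalMono mono1 x) * eval g x  ≈⟨ sym (eval-divisionStep r m mono1 g x) ⟩
      eval (divisionStep r m mono1 g) x                       ≈⟨ step≈0 ⟩
      0#                                                      ∎)
    where
    mono1[x]≉0 : evalMono mono1 x ≉ 0#
    mono1[x]≉0 = 1≉0 ∘ trans (sym (evalMono-mono1 x))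

  monomials : Pol → List (Mono n)
  monomials = map proj₂

  Occurs⇒∈ : ∀ f {u} → Occurs f u → u ∈ monomials f
  Occurs⇒∈ []            occ = ⊥-elim (occ refl)
  Occurs⇒∈ ((a , v) ∷ f) {u} occ with ≡-dec _≟_ v u
  ... | yes ≡.refl = here ≡.refl
  ... | no  _      = there (Occurs⇒∈ f occ)

  coeff≈0-unless-∈ : ∀ f {u} → (u ∈ monomials f → coeff f u ≈ 0#) → coeff f u ≈ 0#
  coeff≈0-unless-∈ []            _ = refl
  coeff≈0-unless-∈ ((a , v) ∷ f) {u} listed≈0 with ≡-dec _≟_ v u
  ... | yes ≡.refl = listed≈0 (here ≡.refl)
  ... | no  _      = coeff≈0-unless-∈ f (listed≈0 ∘ there)

  module _ (O : TermOrder n) where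

    open TermOrder O
    open TermOrderProperties O

    private
      Dominates : Pol → List (Mono n) → Mono n → Set ℓ
      Dominates f L m = ∀ u → u ∈ L → Occurs f u → u ≼ m

      greatest-occurring : ∀ f L →
        ¬ ¬ ((∃ λ m → Occurs f m × Dominates f L m) ⊎ (∀ u → u ∈ L → coeff f u ≈ 0#))
      greatest-occurring f []      k = k (inj₂ λ _ ())
      greatest-occurring f (u ∷ L) k =
        greatest-occurring f L λ ih → ¬¬-excluded-middle λ u≈0? → k (extend ih u≈0?)
        where
        extend : (∃ λ m → Occurs f m × Dominates f L m) ⊎ (∀ v → v ∈ L → coeff f v ≈ 0#) →
                 Dec (coeff f u ≈ 0#) →
                 (∃ λ m → Occurs f m × Dominates f (u ∷ L) m) ⊎ (∀ v → v ∈ u ∷ L → coeff f v ≈ 0#)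
        extend (inj₂ L≈0) (yes u≈0) = inj₂ λ { _ (here ≡.refl) → u≈0 ; v (there v∈L) → L≈0 v v∈L }
        extend (inj₂ L≈0) (no u≉0)  = inj₁ (u , u≉0 , λ
          { _ (here ≡.refl) _ → inj₂ ≡.refl ; v (there v∈L) occ → ⊥-elim (occ (L≈0 v v∈L)) })
        extend (inj₁ (m , occ-m , dom)) (yes u≈0) = inj₁ (m , occ-m , λ
          { _ (here ≡.refl) occ → ⊥-elim (occ u≈0) ; v (there v∈L) → dom v v∈L })
        extend (inj₁ (m , occ-m , dom)) (no u≉0) with ≼-or-≻ u m
        ... | inj₁ u≼m = inj₁ (m , occ-m , λ { _ (here ≡.refl) _ → u≼m ; v (there v∈L) → dom v v∈L })
        ... | inj₂ m≺u = inj₁ (u , u≉0 , λ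
          { _ (here ≡.refl) _ → inj₂ ≡.refl ; v (there v∈L) occ → inj₁ (≼-≺-trans (dom v v∈L occ) m≺u) })

    ∃-leadingMonomial : ∀ f x → eval f x ≉ 0# → ¬ ¬ ∃ (IsLM O f)
    ∃-leadingMonomial f x f≉0 no-lm = greatest-occurring f (monomials f) λ
      { (inj₁ (m , occ-m , dom)) → no-lm (m , occ-m , λ u occ → dom u (Occurs⇒∈ f occ) occ)
      ; (inj₂ listed≈0) → f≉0 (eval-zero-coeffs f (λ u → coeff≈0-unless-∈ f (listed≈0 u)) x) }

    divisionStep-lowers : ∀ r g {m l w} → IsLM O r m → IsLM O g l → coeff g l ≈ 1# → w ·ₘ l ≡ m →
                          ∀ u → Occurs (divisionStep r m w g) u → u ≺ m
    divisionStep-lowers r g {l = l} {w} (_ , r≼m) (_ , g≼l) monic ≡.refl u occ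
      with ≼-or-≻ u (w ·ₘ l)
    ... | inj₁ (inj₁ u≺m)    = u≺m
    ... | inj₁ (inj₂ ≡.refl) = ⊥-elim (occ (begin
      coeff (r ++ scale (- a) w g) (w ·ₘ l)  ≈⟨ coeff-++ r _ (w ·ₘ l) ⟩
      a + coeff (scale (- a) w g) (w ·ₘ l)   ≈⟨ +-cong refl (coeff-scale (- a) w g l) ⟩
      a + - a * coeff g l                    ≈⟨ +-cong refl (trans (*-cong refl monic) (*-identityʳ _)) ⟩
      a + - a                                ≈⟨ -‿inverseʳ a ⟩
      0#                                     ∎))
      where a = coeff r (w ·ₘ l)
    ... | inj₂ m≺u = ⊥-elim (Occurs-++ r _ u occ λ
      { (inj₁ occ-r) → ≺⇒⋡ m≺u (r≼m u occ-r)
      ; (inj₂ occ-s) → let (v , wv≡u , occ-v) = Occurs-scale _ w g u occ-s in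
          ≺⇒⋡ m≺u (≡.subst (_≼ (w ·ₘ l)) wv≡u (·ₘ-monoʳ-≼ w (g≼l v occ-v))) })

    module _ {𝓕 : List Point} {s} {g : Fin s → Pol} {lm : Fin s → Mono n}
             (GB : IsReducedGB O 𝓕 g lm) (lm-increasing : ∀ j k → j < k → lm j ≺ lm k)
             (h : Point) (i : Fin s) (gⱼ[h]≈0 : ∀ j → j < i → eval (g j) h ≈ 0#) where

      open IsReducedGB GB

      lm-reflects-≺ : ∀ {j k} → lm j ≺ lm k → j < k
      lm-reflects-≺ {j} {k} lmⱼ≺lmₖ with <-cmp j k
      ... | tri< j<k _ _    = j<k
      ... | tri≈ _ ≡.refl _ = ⊥-elim (≺⇒⋡ lmⱼ≺lmₖ (inj₂ ≡.refl))
      ... | tri> _ _ k<j    = ⊥-elim (≺⇒⋡ lmⱼ≺lmₖ (inj₁ (lm-increasing k j k<j)))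

      -- Dividing r by 𝓖 only ever uses the gⱼ with j < i, and these vanish at h.
      vanishes-below-lmᵢ : ∀ r → InI 𝓕 r → (∀ u → Occurs r u → u ≺ lm i) → ¬ ¬ (eval r h ≈ 0#)
      vanishes-below-lmᵢ r r∈I r≺lmᵢ r[h]≉0 = ∃-leadingMonomial r h r[h]≉0 λ (m , lm-r) →
        no-leading (≺-wellFounded m) r r∈I r≺lmᵢ r[h]≉0 lm-r
        where
        no-leading : ∀ {m} → Acc _≺_ m → ∀ r → InI 𝓕 r → (∀ u → Occurs r u → u ≺ lm i) →
                     eval r h ≉ 0# → ¬ IsLM O r m
        no-leading {m} (acc rec) r r∈I r≺lmᵢ r[h]≉0 lm-r with lm-generate r m r∈I lm-r
        ... | j , w , lmⱼw≡m = ∃-leadingMonomial r′ h r′[h]≉0 λ (m′ , lm-r′) →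
          no-leading (rec (r′≺m m′ (proj₁ lm-r′))) r′ r′∈I (λ u occ → ≺-trans (r′≺m u occ) m≺lmᵢ)
            r′[h]≉0 lm-r′
          where
          r′ = divisionStep r m w (g j)
          m≺lmᵢ = r≺lmᵢ m (proj₁ lm-r)

          j<i : j < i
          j<i = lm-reflects-≺ (≼-≺-trans (∣ₘ⇒≼ (w , lmⱼw≡m)) m≺lmᵢ)

          r′≺m : ∀ u → Occurs r′ u → u ≺ m
          r′≺m = divisionStep-lowers r (g j) lm-r (lm-is-lm j) (monic j)
                   (≡.trans (·ₘ-comm w (lm j)) lmⱼw≡m)

          r′∈I : InI 𝓕 r′
          r′∈I = InI-divisionStep r m w (g j) r∈I (in-ideal j)

          r′[h]≉0 : eval r′ h ≉ 0#
          r′[h]≉0 = r[h]≉0 ∘ trans (sym (divisionStep-at-root r m w (g j) h (gⱼ[h]≈0 j j<i)))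

      monomials-of-gᵢ-standard : eval (g i) h ≉ 0# → ∀ u → Occurs (g i) u → Standard O (h ∷ 𝓕) u
      monomials-of-gᵢ-standard gᵢ[h]≉0 u occ f f∈I lm-f with lm-generate f u (InI-∷ f f∈I) lm-f
      ... | j , w , lmⱼw≡u with j Fin.≟ i
      ...   | no j≢i = reduced i j (j≢i ∘ ≡.sym) u occ (w , lmⱼw≡u)
      ...   | yes ≡.refl with proj₂ (lm-is-lm i) u occ
      ...     | inj₁ u≺lmᵢ  = ≺⇒⋡ u≺lmᵢ (∣ₘ⇒≼ (w , lmⱼw≡u))
      ...     | inj₂ ≡.refl = vanishes-below-lmᵢ (divisionStep f (lm i) mono1 (g i))
          (InI-divisionStep f (lm i) mono1 (g i) (InI-∷ f f∈I) (in-ideal i))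
          (divisionStep-lowers f (g i) lm-f (lm-is-lm i) (monic i) (·ₘ-identityˡ (lm i)))
          (divisionStep-≉0 f (lm i) (g i) h (f∈I h (here ≡.refl)) (proj₁ lm-f) gᵢ[h]≉0)

corollary3p4 : ∀ {c ℓ : Level} (K : Field c ℓ) (n : ℕ) (O : TermOrder n) →
  let open Field K
      open Poly K n
      open TermOrder O
  in (𝓕 : List Point) (h : Point) →
     (∀ v → v ∈ 𝓕 → ¬ (v ≈ᵥ h)) →
     (s : ℕ) (g : Fin s → Pol) (lm : Fin s → Mono n) →
     IsReducedGB O 𝓕 g lm →
     (∀ j k → j < k → lm j ≺ lm k) →
     (i : Fin s) →
     ¬ (eval (g i) h ≈ 0#) →
     (∀ j → j < i → eval (g j) h ≈ 0#) →
     (a : Carrier) → a * eval (g i) h ≈ 1# →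
     let p = ((a , mono1) ∷ []) *ₚ g i
     in (eval p h ≈ 1#)
        × (∀ v → v ∈ 𝓕 → eval p v ≈ 0#)
        × (∀ u → Occurs p u → Standard O (h ∷ 𝓕) u)
corollary3p4 K n O 𝓕 h _ s g lm GB lm-increasing i gᵢ[h]≉0 gⱼ[h]≈0 a a·gᵢ[h]≈1 =
  p[h]≈1 , InI-scale a mono1 (g i) (IsReducedGB.in-ideal GB i) , p-standard
  where
  open Field K
  open Poly K n
  open PolyProperties K n
  open import Relation.Binary.Reasoning.Setoid setoid

  p[h]≈1 : eval (scale a mono1 (g i)) h ≈ 1#
  p[h]≈1 = begin
    eval (scale a mono1 (g i)) h           ≈⟨ eval-scale a mono1 (g i) h ⟩
    (a * evalMono mono1 h) * eval (g i) h  ≈⟨ *-cong (*-cong refl (evalMono-mono1 h)) refl ⟩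
    (a * 1#) * eval (g i) h                ≈⟨ *-cong (*-identityʳ a) refl ⟩
    a * eval (g i) h                       ≈⟨ a·gᵢ[h]≈1 ⟩
    1#                                     ∎

  p-standard : ∀ u → Occurs (scale a mono1 (g i)) u → Standard O (h ∷ 𝓕) u
  p-standard u occ with Occurs-scale a mono1 (g i) u occ
  ... | v , ≡.refl , occ-v = ≡.subst (Standard O (h ∷ 𝓕)) (≡.sym (·ₘ-identityˡ v))
    (monomials-of-gᵢ-standard O GB lm-increasing h i gⱼ[h]≈0 gᵢ[h]≉0 v occ-v)
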